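{- Let $T(x)=c_0+c_1x+\cdots+c_nx^n\in(\mathbb{Z}/2)[x]$ have degree $n\geq1$ and $c_0\neq0$. Then each of the sequences $k\mapsto|A_1(k)\cap B_1(k)\cap B_2(k)|$ and $k\mapsto|A_2(k)\cap B_1(k)\cap B_2(k)|$ is nonincreasing for $k\geq n$. Hence each is independent of $k$ for all sufficiently large $k$.
   Context: Write $T(x)=c_0+\cdots+c_nx^n$ with $c_n\neq0$. The automaton $A_2(1;T)$ has line $r$ (for $r\geq0$) equal to $T(x)^r\in(\mathbb{Z}/2)[x]$. Each line is identified with the bi-infinite sequence $(a_j)_{j\in\mathbb{Z}}$ of its coefficients, with zeros outside the support. A string $w\in(\mathbb{Z}/2)^k$ is $k$-accessible if $w=(a_j,\dots,a_{j+k-1})$ for some line and some $j\in\mathbb{Z}$. Let $\mathscr{A}(k)$ be the set of $k$-accessible blocks. Define \[A_1(k)=\{x_00x_10\cdots x_{k-1}0: x_0x_1\cdots x_{k-1}\in\mathscr{A}(k)\},\qquad A_2(k)=\{0x_00x_1\cdots0x_{k-1}: x_0\cdots x_{k-1}\in\mathscr{A}(k)\},\] both subsets of $(\mathbb{Z}/2)^{2k}$; strings are written as concatenations. For $i\in\{1,2\}$ let $m_i(k)=k+\lfloor (n+i-1)/2\rfloor$. Define $T_{B_i}:(\mathbb{Z}/2)^{m_i(k)}\to(\mathbb{Z}/2)^{2k}$ by $T_{B_i}(b)=(e_{n+i-1},\dots,e_{n+2k+i-2})$. Here $e_j$ is the coefficient of $x^j$ in $x\,T(x)\,b(x^2)$,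 where $b(x)=\sum_lb_lx^l$. Put $B_i(k)=T_{B_i}(\mathscr{A}(m_i(k)))$. -}

module Defs where

open import Data.Bool using (Bool; true; false; _xor_; if_then_else_)
open import Data.Nat using (ℕ; zero; suc; _+_; _≤_; ⌊_/2⌋)
open import Data.Integer as ℤ using (ℤ; +_; -[1+_])
open import Data.List using (List; []; _∷_; length)
open import Data.List.Membership.Propositional using (_∈_)
open import Data.List.Relation.Unary.Unique.Propositional using (Unique)
open import Data.Vec using (Vec; []; _∷_; tabulate; lookup)
open import Data.Fin using (Fin; toℕ)
open import Data.Product using (Σ; ∃; _×_; _,_)
open import Relation.Binary.PropositionalEquality using (_≡_)
open import Function.Bundles using (_⇔_)

-- Polynomials over ℤ/2 (ℤ/2 = Bool with xor as addition, ∧ as product),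
-- given by coefficient lists: the i-th entry is the coefficient of x^i.
Poly : Set
Poly = List Bool

addP : Poly → Poly → Poly
addP [] q = q
addP (a ∷ p) [] = a ∷ p
addP (a ∷ p) (b ∷ q) = (a xor b) ∷ addP p q

mulP : Poly → Poly → Poly
mulP [] q = []
mulP (a ∷ p) q = addP (if a then q else []) (false ∷ mulP p q)

powP : Poly → ℕ → Poly
powP p zero = true ∷ []
powP p (suc r) = mulP p (powP p r)

coeffℕ : Poly → ℕ → Bool
coeffℕ [] i = false
coeffℕ (a ∷ p) zero = a
coeffℕ (a ∷ p) (suc i) = coeffℕ p i

-- the bi-infinite coefficient sequence (zero outside the support)
coeff : Poly → ℤ → Bool
coeff p (+ i) = coeffℕ p i
coeff p -[1+ i ] = false

blockAt : Poly → ℤ → (k : ℕ) → Vec Bool k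
blockAt p j k = tabulate (λ t → coeff p (j ℤ.+ + toℕ t))

polyOf : ∀ {n} → Vec Bool n → Poly
polyOf [] = []
polyOf (a ∷ v) = a ∷ polyOf v

-- k-accessible blocks of A_2(1;T): blocks of some line T(x)^r, r ≥ 0
Accessible : Poly → (k : ℕ) → Vec Bool k → Set
Accessible T k w = Σ ℕ λ r → Σ ℤ λ j → blockAt (powP T r) j k ≡ w

dbl : ℕ → ℕ
dbl zero = zero
dbl (suc k) = suc (suc (dbl k))

inter1 : ∀ {k} → Vec Bool k → Vec Bool (dbl k)
inter1 [] = []
inter1 (x ∷ xs) = x ∷ false ∷ inter1 xs

inter2 : ∀ {k} → Vec Bool k → Vec Bool (dbl k)
inter2 [] = []
inter2 (x ∷ xs) = false ∷ x ∷ inter2 xs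

A₁ : Poly → (k : ℕ) → Vec Bool (dbl k) → Set
A₁ T k w = Σ (Vec Bool k) λ x → Accessible T k x × inter1 x ≡ w

A₂ : Poly → (k : ℕ) → Vec Bool (dbl k) → Set
A₂ T k w = Σ (Vec Bool k) λ x → Accessible T k x × inter2 x ≡ w

spread : ∀ {m} → Vec Bool m → Poly
spread [] = []
spread (b ∷ bs) = b ∷ false ∷ spread bs

m₁ m₂ : ℕ → ℕ → ℕ
m₁ n k = k + ⌊ n /2⌋
m₂ n k = k + ⌊ suc n /2⌋

TB : Poly → (s k : ℕ) → ∀ {m} → Vec Bool m → Vec Bool (dbl k)
TB T s k b = tabulate (λ t → coeffℕ (false ∷ mulP T (spread b)) (s + toℕ t))

B₁ : (n : ℕ) → Poly → (k : ℕ) → Vec Bool (dbl k) → Set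
B₁ n T k w = Σ (Vec Bool (m₁ n k)) λ b → Accessible T (m₁ n k) b × TB T n k b ≡ w

B₂ : (n : ℕ) → Poly → (k : ℕ) → Vec Bool (dbl k) → Set
B₂ n T k w = Σ (Vec Bool (m₂ n k)) λ b → Accessible T (m₂ n k) b × TB T (suc n) k b ≡ w

-- |S| = c for a subset S of a finite type: S is exactly the set of
-- elements of a duplicate-free list of length c (proof-irrelevant counting).
HasCard : {A : Set} → (A → Set) → ℕ → Set
HasCard {A} S c = Σ (List A) λ l → Unique l × length l ≡ c × (∀ a → (a ∈ l) ⇔ S a)

S₁ S₂ : (n : ℕ) → Poly → (k : ℕ) → Vec Bool (dbl k) → Set
S₁ n T k w = A₁ T k w × B₁ n T k w × B₂ n T k w
S₂ n T k w = A₂ T k w × B₁ n T k w × B₂ n T k w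

NonincreasingFrom : ℕ → ((k : ℕ) → Vec Bool (dbl k) → Set) → Set
NonincreasingFrom n S = ∀ k → n ≤ k → ∀ c c' → HasCard (S k) c → HasCard (S (suc k)) c' → c' ≤ c

module Submission where

-- Deleting the last two letters maps Aᵢ(k+1) ∩ B₁(k+1) ∩ B₂(k+1) into Aᵢ(k) ∩ B₁(k) ∩ B₂(k), so it
-- is enough that this map is injective on B₁(k+1) ∩ B₂(k+1). A word there is read off x·T·b(x²)
-- from xⁿ and off x·T·b′(x²) from xⁿ⁺¹. Over ℤ/2 we have T² = T(x²), so T·x·T·b(x²) has only odd
-- powers of x. Comparing two words that agree up to their last two letters, their differences
-- give polynomials Z, W (the first shifted once more) whose coefficients from xⁿ⁺¹ on agree and
-- such that T·Z has only even and T·W only odd powers. Because T has constant term 1, a run of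
-- deg T ≤ k zero coefficients of Z then forces all following ones within the window to vanish.

open import Defs
open import Algebra.Bundles using (CommutativeRing)
open import Data.Bool using (Bool; true; false; _xor_; _∧_; if_then_else_)
open import Data.Bool.Properties
  using (xor-identityʳ; xor-same; ∧-zeroʳ; ∧-distribˡ-xor; xor-∧-commutativeRing)
open import Data.Fin using (zero; fromℕ; fromℕ<; toℕ)
open import Data.Fin.Properties using (toℕ<n; toℕ-fromℕ<)
import Data.Integer as ℤ
open import Data.List using (List; []; _∷_; length)
open import Data.List.Membership.Propositional using (_∈_; _─_)
open import Data.List.Properties using (length-removeAt′)
open import Data.List.Relation.Unary.All as All using ()
open import Data.List.Relation.Unary.AllPairs using (_∷_)
open import Data.List.Relation.Unary.Any using (here; there; index)
open import Data.List.Relation.Unary.Unique.Propositional using (Unique)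
open import Data.Nat using (ℕ; zero; suc; _+_; _≤_; _<_; _≤?_; z≤n; s≤s; z<s; s≤s⁻¹; ⌊_/2⌋)
open import Data.Nat.Properties
open import Data.Product using (∃; _×_; _,_)
open import Data.Sum using (_⊎_; inj₁; inj₂)
open import Data.Vec using (Vec; []; _∷_; tabulate; lookup)
open import Data.Vec.Properties using (tabulate-cong; lookup∘tabulate)
open import Function using (_∘_)
open import Function.Bundles using (module Equivalence)
open import Relation.Binary.PropositionalEquality
open import Relation.Nullary using (yes; no; contradiction)

open import Algebra.Properties.CommutativeSemigroup
  (CommutativeRing.+-commutativeSemigroup xor-∧-commutativeRing)
  using () renaming (interchange to xor-interchange)

private variable
  A B : Set
  m : ℕ
  p q : Poly

infix 4 _≈_
_≈_ : Poly → Poly → Set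
p ≈ q = ∀ i → coeffℕ p i ≡ coeffℕ q i

x∷-cong : p ≈ q → (false ∷ p) ≈ (false ∷ q)
x∷-cong p≈q zero = refl
x∷-cong p≈q (suc i) = p≈q i

x∷[]≈[] : (false ∷ []) ≈ []
x∷[]≈[] zero = refl
x∷[]≈[] (suc i) = refl

coeff-addP : ∀ p q i → coeffℕ (addP p q) i ≡ coeffℕ p i xor coeffℕ q i
coeff-addP [] q i = refl
coeff-addP (a ∷ p) [] zero = sym (xor-identityʳ a)
coeff-addP (a ∷ p) [] (suc i) = sym (xor-identityʳ _)
coeff-addP (a ∷ p) (b ∷ q) zero = refl
coeff-addP (a ∷ p) (b ∷ q) (suc i) = coeff-addP p q i

coeff-mulP-∷ : ∀ a p q i →
  coeffℕ (mulP (a ∷ p) q) i ≡ (a ∧ coeffℕ q i) xor coeffℕ (false ∷ mulP p q) i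
coeff-mulP-∷ a p q i =
  trans (coeff-addP (if a then q else []) (false ∷ mulP p q) i) (cong (_xor _) (coeff-if a))
  where
  coeff-if : ∀ a → coeffℕ (if a then q else []) i ≡ a ∧ coeffℕ q i
  coeff-if false = refl
  coeff-if true = refl

mulP-zeroʳ : ∀ p → mulP p [] ≈ []
mulP-zeroʳ [] i = refl
mulP-zeroʳ (a ∷ p) i = begin
  coeffℕ (mulP (a ∷ p) []) i                      ≡⟨ coeff-mulP-∷ a p [] i ⟩
  (a ∧ false) xor coeffℕ (false ∷ mulP p []) i    ≡⟨ cong₂ _xor_ (∧-zeroʳ a) shifted ⟩
  false                                           ∎
  where
  open ≡-Reasoning
  shifted = trans (x∷-cong (mulP-zeroʳ p) i) (x∷[]≈[] i)

mulP-distribˡ-addP : ∀ p q r → mulP p (addP q r) ≈ addP (mulP p q) (mulP p r)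
mulP-distribˡ-addP [] q r i = refl
mulP-distribˡ-addP (a ∷ p) q r i = begin
  coeffℕ (mulP (a ∷ p) (addP q r)) i
    ≡⟨ coeff-mulP-∷ a p (addP q r) i ⟩
  (a ∧ coeffℕ (addP q r) i) xor coeffℕ (false ∷ mulP p (addP q r)) i
    ≡⟨ cong₂ _xor_ (cong (a ∧_) (coeff-addP q r i)) (x∷-cong (mulP-distribˡ-addP p q r) i) ⟩
  (a ∧ (qᵢ xor rᵢ)) xor coeffℕ (addP (false ∷ mulP p q) (false ∷ mulP p r)) i
    ≡⟨ cong₂ _xor_ (∧-distribˡ-xor a qᵢ rᵢ) (coeff-addP (false ∷ mulP p q) (false ∷ mulP p r) i) ⟩
  ((a ∧ qᵢ) xor (a ∧ rᵢ)) xor (coeffℕ (false ∷ mulP p q) i xor coeffℕ (false ∷ mulP p r) i)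
    ≡⟨ xor-interchange (a ∧ qᵢ) (a ∧ rᵢ) (coeffℕ (false ∷ mulP p q) i) (coeffℕ (false ∷ mulP p r) i) ⟩
  ((a ∧ qᵢ) xor coeffℕ (false ∷ mulP p q) i) xor ((a ∧ rᵢ) xor coeffℕ (false ∷ mulP p r) i)
    ≡⟨ cong₂ _xor_ (coeff-mulP-∷ a p q i) (coeff-mulP-∷ a p r i) ⟨
  coeffℕ (mulP (a ∷ p) q) i xor coeffℕ (mulP (a ∷ p) r) i
    ≡⟨ coeff-addP (mulP (a ∷ p) q) (mulP (a ∷ p) r) i ⟨
  coeffℕ (addP (mulP (a ∷ p) q) (mulP (a ∷ p) r)) i
    ∎
  where
  open ≡-Reasoning
  qᵢ = coeffℕ q i
  rᵢ = coeffℕ r i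

mulP-x∷ʳ : ∀ p q → mulP p (false ∷ q) ≈ (false ∷ mulP p q)
mulP-x∷ʳ [] q i = sym (x∷[]≈[] i)
mulP-x∷ʳ (a ∷ p) q zero = trans (coeff-mulP-∷ a p (false ∷ q) zero) (cong (_xor false) (∧-zeroʳ a))
mulP-x∷ʳ (a ∷ p) q (suc i) = begin
  coeffℕ (mulP (a ∷ p) (false ∷ q)) (suc i)            ≡⟨ coeff-mulP-∷ a p (false ∷ q) (suc i) ⟩
  (a ∧ coeffℕ q i) xor coeffℕ (mulP p (false ∷ q)) i   ≡⟨ cong ((a ∧ coeffℕ q i) xor_) (mulP-x∷ʳ p q i) ⟩
  (a ∧ coeffℕ q i) xor coeffℕ (false ∷ mulP p q) i     ≡⟨ coeff-mulP-∷ a p q i ⟨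
  coeffℕ (mulP (a ∷ p) q) i                            ∎
  where open ≡-Reasoning

coeff-mulP-local : ∀ p q r j →
  (∀ i → i ≤ j → j < i + length p → coeffℕ q i ≡ coeffℕ r i) →
  coeffℕ (mulP p q) j ≡ coeffℕ (mulP p r) j
coeff-mulP-local [] q r j _ = refl
coeff-mulP-local (a ∷ p) q r j q≈r = begin
  coeffℕ (mulP (a ∷ p) q) j
    ≡⟨ coeff-mulP-∷ a p q j ⟩
  (a ∧ coeffℕ q j) xor coeffℕ (false ∷ mulP p q) j
    ≡⟨ cong₂ (λ u v → (a ∧ u) xor v) (q≈r j ≤-refl (m<m+n j z<s)) (lower j q≈r) ⟩
  (a ∧ coeffℕ r j) xor coeffℕ (false ∷ mulP p r) j
    ≡⟨ coeff-mulP-∷ a p r j ⟨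
  coeffℕ (mulP (a ∷ p) r) j
    ∎
  where
  open ≡-Reasoning
  lower : ∀ j → (∀ i → i ≤ j → j < i + suc (length p) → coeffℕ q i ≡ coeffℕ r i) →
          coeffℕ (false ∷ mulP p q) j ≡ coeffℕ (false ∷ mulP p r) j
  lower zero _ = refl
  lower (suc j) q≈r = coeff-mulP-local p q r j λ i i≤j j<i+l →
    q≈r i (m≤n⇒m≤1+n i≤j) (subst (suc j <_) (sym (+-suc i (length p))) (s≤s j<i+l))

coeff-mulP-monic : ∀ p Z j →
  (∀ i → i < j → j ≤ i + length p → coeffℕ Z i ≡ false) →
  coeffℕ (mulP (true ∷ p) Z) j ≡ coeffℕ Z j
coeff-mulP-monic p Z j below = begin
  coeffℕ (mulP (true ∷ p) Z) j                ≡⟨ coeff-mulP-∷ true p Z j ⟩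
  coeffℕ Z j xor coeffℕ (false ∷ mulP p Z) j  ≡⟨ cong (coeffℕ Z j xor_) (lower j below) ⟩
  coeffℕ Z j xor false                        ≡⟨ xor-identityʳ _ ⟩
  coeffℕ Z j                                  ∎
  where
  open ≡-Reasoning
  lower : ∀ j → (∀ i → i < j → j ≤ i + length p → coeffℕ Z i ≡ false) →
          coeffℕ (false ∷ mulP p Z) j ≡ false
  lower zero _ = refl
  lower (suc j) below =
    trans (coeff-mulP-local p Z [] j (λ i i≤j j<i+l → below i (s≤s i≤j) j<i+l)) (mulP-zeroʳ p j)

EvenPoly OddPoly : Poly → Set
EvenPoly q = ∀ i → coeffℕ q (suc (i + i)) ≡ false
OddPoly q = ∀ i → coeffℕ q (i + i) ≡ false

even⊎odd : ∀ j → ∃ λ i → j ≡ i + i ⊎ j ≡ suc (i + i)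
even⊎odd zero = 0 , inj₁ refl
even⊎odd (suc j) with even⊎odd j
... | i , inj₁ refl = i , inj₂ refl
... | i , inj₂ refl = suc i , inj₁ (cong suc (sym (+-suc i i)))

spread-EvenPoly : (b : Vec Bool m) → EvenPoly (spread b)
spread-EvenPoly [] i = refl
spread-EvenPoly (_ ∷ b) zero = refl
spread-EvenPoly (_ ∷ b) (suc i) =
  subst (λ j → coeffℕ (spread b) j ≡ false) (sym (+-suc i i)) (spread-EvenPoly b i)

mulP-x∷-OddPoly : ∀ p q → EvenPoly (mulP p q) → OddPoly (mulP p (false ∷ q))
mulP-x∷-OddPoly p q even zero = mulP-x∷ʳ p q 0
mulP-x∷-OddPoly p q even (suc i) =
  trans (mulP-x∷ʳ p q (suc i + suc i))
        (subst (λ j → coeffℕ (mulP p q) j ≡ false) (sym (+-suc i i)) (even i))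

mulP-x∷-EvenPoly : ∀ p q → OddPoly (mulP p q) → EvenPoly (mulP p (false ∷ q))
mulP-x∷-EvenPoly p q odd i = trans (mulP-x∷ʳ p q (suc (i + i))) (odd i)

mulP-addP-OddPoly : ∀ p q r → OddPoly (mulP p q) → OddPoly (mulP p r) → OddPoly (mulP p (addP q r))
mulP-addP-OddPoly p q r odd odd′ i = begin
  coeffℕ (mulP p (addP q r)) i+i                         ≡⟨ mulP-distribˡ-addP p q r i+i ⟩
  coeffℕ (addP (mulP p q) (mulP p r)) i+i                ≡⟨ coeff-addP (mulP p q) (mulP p r) i+i ⟩
  coeffℕ (mulP p q) i+i xor coeffℕ (mulP p r) i+i        ≡⟨ cong₂ _xor_ (odd i) (odd′ i) ⟩
  false                                                  ∎
  where
  open ≡-Reasoning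
  i+i = i + i

-- In characteristic 2, p² = p(x²) is itself a polynomial in x².
mulP-mulP-EvenPoly : ∀ p {q} → EvenPoly q → EvenPoly (mulP p (mulP p q))
mulP-mulP-EvenPoly [] even i = refl
mulP-mulP-EvenPoly (false ∷ p) {q} even = mulP-x∷-OddPoly p (mulP p q) (mulP-mulP-EvenPoly p even)
mulP-mulP-EvenPoly (true ∷ p) {q} even i = begin
  coeffℕ (mulP (true ∷ p) R) (suc (i + i))
    ≡⟨ coeff-addP R (false ∷ mulP p R) (suc (i + i)) ⟩
  coeffℕ R (suc (i + i)) xor coeffℕ (mulP p R) (i + i)
    ≡⟨ cong₂ _xor_ (coeff-addP q (false ∷ mulP p q) (suc (i + i)))
                   (mulP-distribˡ-addP p q (false ∷ mulP p q) (i + i)) ⟩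
  (coeffℕ q (suc (i + i)) xor x) xor coeffℕ (addP (mulP p q) (mulP p (false ∷ mulP p q))) (i + i)
    ≡⟨ cong₂ _xor_ (cong (_xor x) (even i)) (coeff-addP (mulP p q) (mulP p (false ∷ mulP p q)) (i + i)) ⟩
  x xor (x xor coeffℕ (mulP p (false ∷ mulP p q)) (i + i))
    ≡⟨ cong (λ u → x xor (x xor u)) (mulP-x∷-OddPoly p (mulP p q) (mulP-mulP-EvenPoly p even) i) ⟩
  x xor (x xor false)
    ≡⟨ cong (x xor_) (xor-identityʳ x) ⟩
  x xor x
    ≡⟨ xor-same x ⟩
  false ∎
  where
  open ≡-Reasoning
  R = mulP (true ∷ p) q
  x = coeffℕ (mulP p q) (i + i)

-- As T = 1 + ⋯, the coefficient of xʲ in T·Z is that of Z once the deg T coefficients of Z below j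
-- vanish, and T·Z agrees with T·W at xʲ once Z and W agree on the deg T + 1 coefficients up to j.
-- Since at every j one of the two products vanishes, zeros of Z spread upwards.
zeros-propagate : ∀ p Z W a b →
  (∀ j → coeffℕ (mulP (true ∷ p) Z) j ≡ false ⊎ coeffℕ (mulP (true ∷ p) W) j ≡ false) →
  (∀ t → t < b → coeffℕ Z (a + t) ≡ coeffℕ W (a + t)) →
  (∀ t → t < length p → coeffℕ Z (a + t) ≡ false) →
  ∀ t → t < b → coeffℕ Z (a + t) ≡ false
zeros-propagate p Z W a b one-vanishes Z≈W start t t<b = vanish-below b ≤-refl t t<b
  where
  l = length p

  VanishBelow : ℕ → Set
  VanishBelow m = ∀ t → t < m → coeffℕ Z (a + t) ≡ false

  offset : ∀ {m i} → l ≤ m → a + m ≤ i + l → ∃ λ d → a + d ≡ i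
  offset l≤m a+m≤i+l = _ , m+[n∸m]≡n (+-cancelʳ-≤ l _ _ (≤-trans (+-monoʳ-≤ a l≤m) a+m≤i+l))

  step : ∀ m → m < b → VanishBelow m → coeffℕ Z (a + m) ≡ false
  step m m<b below with l ≤? m
  ... | no m<l = start m (≰⇒> m<l)
  ... | yes l≤m = trans (sym (coeff-mulP-monic p Z (a + m) zero-window)) TZ≡0
    where
    zero-window : ∀ i → i < a + m → a + m ≤ i + l → coeffℕ Z i ≡ false
    zero-window i i<a+m a+m≤i+l with offset l≤m a+m≤i+l
    ... | d , refl = below d (+-cancelˡ-< a d m i<a+m)

    agree-window : ∀ i → i ≤ a + m → a + m < i + suc l → coeffℕ Z i ≡ coeffℕ W i
    agree-window i i≤a+m a+m<i+1+l with offset l≤m (s≤s⁻¹ (subst (a + m <_) (+-suc i l) a+m<i+1+l))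
    ... | d , refl = Z≈W d (≤-<-trans (+-cancelˡ-≤ a d m i≤a+m) m<b)

    TZ≡0 : coeffℕ (mulP (true ∷ p) Z) (a + m) ≡ false
    TZ≡0 with one-vanishes (a + m)
    ... | inj₁ TZ≡0 = TZ≡0
    ... | inj₂ TW≡0 = trans (coeff-mulP-local (true ∷ p) Z W (a + m) agree-window) TW≡0

  vanish-below : ∀ m → m ≤ b → VanishBelow m
  vanish-below zero _ _ ()
  vanish-below (suc m) 1+m≤b t t<1+m with m<1+n⇒m<n∨m≡n t<1+m
  ... | inj₁ t<m = vanish-below m (<⇒≤ 1+m≤b) t t<m
  ... | inj₂ refl = step m 1+m≤b (vanish-below m (<⇒≤ 1+m≤b))

tabulate-cong< : {f g : ℕ → A} → (∀ i → i < m → f i ≡ g i) →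
                 tabulate {n = m} (f ∘ toℕ) ≡ tabulate (g ∘ toℕ)
tabulate-cong< f≡g = tabulate-cong (λ i → f≡g (toℕ i) (toℕ<n i))

tabulate-injective< : {f g : ℕ → A} → tabulate {n = m} (f ∘ toℕ) ≡ tabulate (g ∘ toℕ) →
                      ∀ i → i < m → f i ≡ g i
tabulate-injective< {f = f} {g} eq i i<m = begin
  f i                                   ≡⟨ cong f (toℕ-fromℕ< i<m) ⟨
  f (toℕ i′)                            ≡⟨ lookup∘tabulate (f ∘ toℕ) i′ ⟨
  lookup (tabulate (f ∘ toℕ)) i′        ≡⟨ cong (λ v → lookup v i′) eq ⟩
  lookup (tabulate (g ∘ toℕ)) i′        ≡⟨ lookup∘tabulate (g ∘ toℕ) i′ ⟩
  g (toℕ i′)                            ≡⟨ cong g (toℕ-fromℕ< i<m) ⟩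
  g i                                   ∎
  where
  open ≡-Reasoning
  i′ = fromℕ< i<m

dropLast : Vec A (suc m) → Vec A m
dropLast {m = zero} (_ ∷ []) = []
dropLast {m = suc m} (x ∷ xs) = x ∷ dropLast xs

dropLast-tabulate : ∀ m (f : ℕ → A) → dropLast (tabulate {n = suc m} (f ∘ toℕ)) ≡ tabulate (f ∘ toℕ)
dropLast-tabulate zero f = refl
dropLast-tabulate (suc m) f = cong (f 0 ∷_) (dropLast-tabulate m (f ∘ suc))

truncate : ∀ k → Vec A (dbl (suc k)) → Vec A (dbl k)
truncate k = dropLast ∘ dropLast

truncate-tabulate : ∀ k (f : ℕ → A) → truncate k (tabulate (f ∘ toℕ)) ≡ tabulate (f ∘ toℕ)
truncate-tabulate k f =
  trans (cong dropLast (dropLast-tabulate (suc (dbl k)) f)) (dropLast-tabulate (dbl k) f)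

truncate-inter1 : ∀ k (x : Vec Bool (suc k)) → truncate k (inter1 x) ≡ inter1 (dropLast x)
truncate-inter1 zero (_ ∷ []) = refl
truncate-inter1 (suc k) (x ∷ xs) = cong (λ v → x ∷ false ∷ v) (truncate-inter1 k xs)

truncate-inter2 : ∀ k (x : Vec Bool (suc k)) → truncate k (inter2 x) ≡ inter2 (dropLast x)
truncate-inter2 zero (_ ∷ []) = refl
truncate-inter2 (suc k) (x ∷ xs) = cong (λ v → false ∷ x ∷ v) (truncate-inter2 k xs)

spread-dropLast : (b : Vec Bool (suc m)) → ∀ i → i < dbl m →
                  coeffℕ (spread (dropLast b)) i ≡ coeffℕ (spread b) i
spread-dropLast {suc m} (x ∷ b) zero _ = refl
spread-dropLast {suc m} (x ∷ b) (suc zero) _ = refl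
spread-dropLast {suc m} (x ∷ b) (suc (suc i)) (s≤s (s≤s i<2m)) = spread-dropLast b i i<2m

xTb : Poly → Vec Bool m → Poly
xTb T b = false ∷ mulP T (spread b)

coeff-xTb-dropLast : ∀ T (b : Vec Bool (suc m)) u → u ≤ dbl m →
                     coeffℕ (xTb T (dropLast b)) u ≡ coeffℕ (xTb T b) u
coeff-xTb-dropLast T b zero _ = refl
coeff-xTb-dropLast T b (suc j) j<2m =
  coeff-mulP-local T _ _ j (λ i i≤j _ → spread-dropLast b i (≤-<-trans i≤j j<2m))

mulP-xTb-OddPoly : ∀ T (b : Vec Bool m) → OddPoly (mulP T (xTb T b))
mulP-xTb-OddPoly T b = mulP-x∷-OddPoly T _ (mulP-mulP-EvenPoly T (spread-EvenPoly b))

-- B₁ n = Bₛ n and B₂ n = Bₛ (suc n), definitionally.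
Bₛ : ℕ → Poly → (k : ℕ) → Vec Bool (dbl k) → Set
Bₛ s T k w = ∃ λ (b : Vec Bool (k + ⌊ s /2⌋)) → Accessible T (k + ⌊ s /2⌋) b × TB T s k b ≡ w

dbl-+ : ∀ a b → dbl (a + b) ≡ dbl a + dbl b
dbl-+ zero b = refl
dbl-+ (suc a) b = cong (suc ∘ suc) (dbl-+ a b)

k≤dbl-k : ∀ k → k ≤ dbl k
k≤dbl-k zero = z≤n
k≤dbl-k (suc k) = s≤s (m≤n⇒m≤1+n (k≤dbl-k k))

s≤1+dbl⌊s/2⌋ : ∀ s → s ≤ suc (dbl ⌊ s /2⌋)
s≤1+dbl⌊s/2⌋ zero = z≤n
s≤1+dbl⌊s/2⌋ (suc zero) = s≤s z≤n
s≤1+dbl⌊s/2⌋ (suc (suc s)) = s≤s (s≤s (s≤1+dbl⌊s/2⌋ s))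

TB-window : ∀ s k {t} → t < dbl k → s + t ≤ dbl (k + ⌊ s /2⌋)
TB-window s k {t} t<2k = s≤s⁻¹ (begin-strict
  s + t                          <⟨ +-monoʳ-< s t<2k ⟩
  s + dbl k                      ≤⟨ +-monoˡ-≤ (dbl k) (s≤1+dbl⌊s/2⌋ s) ⟩
  suc (dbl ⌊ s /2⌋ + dbl k)      ≡⟨ cong suc (+-comm (dbl ⌊ s /2⌋) (dbl k)) ⟩
  suc (dbl k + dbl ⌊ s /2⌋)      ≡⟨ cong suc (dbl-+ k ⌊ s /2⌋) ⟨
  suc (dbl (k + ⌊ s /2⌋))        ∎)
  where open ≤-Reasoning

TB-dropLast : ∀ T s k (b : Vec Bool (suc (k + ⌊ s /2⌋))) →
              TB T s k (dropLast b) ≡ truncate k (TB T s (suc k) b)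
TB-dropLast T s k b = begin
  TB T s k (dropLast b)
    ≡⟨ tabulate-cong< (λ t t<2k → coeff-xTb-dropLast T b (s + t) (TB-window s k t<2k)) ⟩
  tabulate (coeffℕ (xTb T b) ∘ (s +_) ∘ toℕ)
    ≡⟨ truncate-tabulate k (coeffℕ (xTb T b) ∘ (s +_)) ⟨
  truncate k (TB T s (suc k) b)
    ∎
  where open ≡-Reasoning

Accessible-dropLast : ∀ {T} {b : Vec Bool (suc m)} →
                      Accessible T (suc m) b → Accessible T m (dropLast b)
Accessible-dropLast {m} {T} (r , j , refl) =
  r , j , sym (dropLast-tabulate m (λ u → coeff (powP T r) (j ℤ.+ ℤ.+ u)))

A₁-truncate : ∀ {T k w} → A₁ T (suc k) w → A₁ T k (truncate k w)
A₁-truncate {k = k} (x , acc , refl) = dropLast x , Accessible-dropLast acc , sym (truncate-inter1 k x)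

A₂-truncate : ∀ {T k w} → A₂ T (suc k) w → A₂ T k (truncate k w)
A₂-truncate {k = k} (x , acc , refl) = dropLast x , Accessible-dropLast acc , sym (truncate-inter2 k x)

Bₛ-truncate : ∀ s {T k w} → Bₛ s T (suc k) w → Bₛ s T k (truncate k w)
Bₛ-truncate s {T} {k} (b , acc , refl) = dropLast b , Accessible-dropLast acc , TB-dropLast T s k b

xor≡false⇒≡ : ∀ x y → x xor y ≡ false → x ≡ y
xor≡false⇒≡ false false _ = refl
xor≡false⇒≡ true true _ = refl

-- With Z = x²T·(b₁ + b₁′)(x²) and W = xT·(b₂ + b₂′)(x²), the coefficients of Z and W from x^{s+1}
-- on both spell w + w′, while T·Z has only even and T·W only odd powers.
Bₛ∩Bₛ₊₁-truncate-injective : ∀ s k p → length p ≤ dbl k → ∀ {w w′} →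
  Bₛ s (true ∷ p) (suc k) w → Bₛ (suc s) (true ∷ p) (suc k) w →
  Bₛ s (true ∷ p) (suc k) w′ → Bₛ (suc s) (true ∷ p) (suc k) w′ →
  truncate k w ≡ truncate k w′ → w ≡ w′
Bₛ∩Bₛ₊₁-truncate-injective s k p l≤2k
  (b₁ , _ , refl) (b₂ , _ , b₂↦w) (b₁′ , _ , refl) (b₂′ , _ , b₂′↦w′) prefix =
  tabulate-cong< {f = f b₁} {g = f b₁′} λ t t<2k+2 →
    xor≡false⇒≡ _ _ (trans (sym (coeff-Z t)) (Z-vanishes t t<2k+2))
  where
  T = true ∷ p
  f : Vec Bool (suc k + ⌊ s /2⌋) → ℕ → Bool
  f b = coeffℕ (xTb T b) ∘ (s +_)
  Z = false ∷ addP (xTb T b₁) (xTb T b₁′)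
  W = addP (xTb T b₂) (xTb T b₂′)

  coeff-Z : ∀ t → coeffℕ Z (suc s + t) ≡ f b₁ t xor f b₁′ t
  coeff-Z t = coeff-addP (xTb T b₁) (xTb T b₁′) (s + t)

  agree : ∀ t → t < dbl (suc k) → coeffℕ Z (suc s + t) ≡ coeffℕ W (suc s + t)
  agree t t<2k+2 = begin
    coeffℕ Z (suc s + t)
      ≡⟨ coeff-Z t ⟩
    f b₁ t xor f b₁′ t
      ≡⟨ cong₂ _xor_ (same b₁ b₂ b₂↦w) (same b₁′ b₂′ b₂′↦w′) ⟨
    coeffℕ (xTb T b₂) (suc s + t) xor coeffℕ (xTb T b₂′) (suc s + t)
      ≡⟨ coeff-addP (xTb T b₂) (xTb T b₂′) (suc s + t) ⟨
    coeffℕ W (suc s + t)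
      ∎
    where
    open ≡-Reasoning
    same : ∀ b b′ → TB T (suc s) (suc k) b′ ≡ TB T s (suc k) b →
           coeffℕ (xTb T b′) (suc s + t) ≡ f b t
    same b b′ eq = tabulate-injective< {f = coeffℕ (xTb T b′) ∘ (suc s +_)} {g = f b} eq t t<2k+2

  equal-prefix : ∀ t → t < dbl k → f b₁ t ≡ f b₁′ t
  equal-prefix = tabulate-injective< {f = f b₁} {g = f b₁′}
    (trans (sym (truncate-tabulate k (f b₁))) (trans prefix (truncate-tabulate k (f b₁′))))

  start : ∀ t → t < length p → coeffℕ Z (suc s + t) ≡ false
  start t t<l = begin
    coeffℕ Z (suc s + t)  ≡⟨ coeff-Z t ⟩
    f b₁ t xor f b₁′ t    ≡⟨ cong (f b₁ t xor_) (equal-prefix t (<-≤-trans t<l l≤2k)) ⟨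
    f b₁ t xor f b₁ t     ≡⟨ xor-same (f b₁ t) ⟩
    false                 ∎
    where open ≡-Reasoning

  sum-OddPoly : (b b′ : Vec Bool m) → OddPoly (mulP T (addP (xTb T b) (xTb T b′)))
  sum-OddPoly b b′ = mulP-addP-OddPoly T (xTb T b) (xTb T b′) (mulP-xTb-OddPoly T b) (mulP-xTb-OddPoly T b′)

  one-vanishes : ∀ j → coeffℕ (mulP T Z) j ≡ false ⊎ coeffℕ (mulP T W) j ≡ false
  one-vanishes j with even⊎odd j
  ... | i , inj₁ refl = inj₂ (sum-OddPoly b₂ b₂′ i)
  ... | i , inj₂ refl = inj₁ (mulP-x∷-EvenPoly T (addP (xTb T b₁) (xTb T b₁′)) (sum-OddPoly b₁ b₁′) i)

  Z-vanishes : ∀ t → t < dbl (suc k) → coeffℕ Z (suc s + t) ≡ false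
  Z-vanishes = zeros-propagate p Z W (suc s) (dbl (suc k)) one-vanishes agree start

∈-─ : ∀ {x y : A} {xs} (x∈xs : x ∈ xs) → y ∈ xs → y ≢ x → y ∈ xs ─ x∈xs
∈-─ (here refl) (here refl) y≢x = contradiction refl y≢x
∈-─ (here refl) (there y∈xs) _ = y∈xs
∈-─ (there _) (here y≡z) _ = here y≡z
∈-─ (there x∈xs) (there y∈xs) y≢x = there (∈-─ x∈xs y∈xs y≢x)

length-≤-injection : (f : A → B) {xs : List A} (ys : List B) → Unique xs →
  (∀ {x} → x ∈ xs → f x ∈ ys) → (∀ {x y} → x ∈ xs → y ∈ xs → f x ≡ f y → x ≡ y) →
  length xs ≤ length ys
length-≤-injection f {[]} ys _ _ _ = z≤n
length-≤-injection f {x ∷ xs} ys (x∉xs ∷ unique) into inj = begin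
  suc (length xs)              ≤⟨ s≤s (length-≤-injection f (ys ─ fx∈ys) unique into′ inj′) ⟩
  suc (length (ys ─ fx∈ys))    ≡⟨ length-removeAt′ ys (index fx∈ys) ⟨
  length ys                    ∎
  where
  open ≤-Reasoning
  fx∈ys = into (here refl)
  into′ : ∀ {y} → y ∈ xs → f y ∈ ys ─ fx∈ys
  into′ y∈xs = ∈-─ fx∈ys (into (there y∈xs))
    (λ fy≡fx → All.lookup x∉xs y∈xs (sym (inj (there y∈xs) (here refl) fy≡fx)))
  inj′ : ∀ {y z} → y ∈ xs → z ∈ xs → f y ≡ f z → y ≡ z
  inj′ y∈xs z∈xs = inj (there y∈xs) (there z∈xs)

HasCard-≤ : {S : A → Set} {S′ : B → Set} (f : A → B) → (∀ {a} → S a → S′ (f a)) →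
  (∀ {a a′} → S a → S a′ → f a ≡ f a′ → a ≡ a′) →
  ∀ {c c′} → HasCard S c → HasCard S′ c′ → c ≤ c′
HasCard-≤ f into inj (xs , unique , refl , xs≡S) (ys , _ , refl , ys≡S′) =
  length-≤-injection f ys unique
    (λ x∈xs → from (ys≡S′ _) (into (to (xs≡S _) x∈xs)))
    (λ x∈xs y∈xs → inj (to (xs≡S _) x∈xs) (to (xs≡S _) y∈xs))
  where open Equivalence

Aᵢ∩B₁∩B₂-nonincreasing : ∀ n p → length p ≤ n → (Aᵢ : Poly → (k : ℕ) → Vec Bool (dbl k) → Set) →
  (∀ {k w} → Aᵢ (true ∷ p) (suc k) w → Aᵢ (true ∷ p) k (truncate k w)) →
  NonincreasingFrom n (λ k w → Aᵢ (true ∷ p) k w × B₁ n (true ∷ p) k w × B₂ n (true ∷ p) k w)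
Aᵢ∩B₁∩B₂-nonincreasing n p deg≤n Aᵢ Aᵢ-truncate k n≤k _ _ card card′ =
  HasCard-≤ (truncate k)
    (λ (a , b₁ , b₂) → Aᵢ-truncate a , Bₛ-truncate n b₁ , Bₛ-truncate (suc n) b₂)
    (λ (_ , b₁ , b₂) (_ , b₁′ , b₂′) → Bₛ∩Bₛ₊₁-truncate-injective n k p deg≤2k b₁ b₂ b₁′ b₂′)
    card′ card
  where deg≤2k = ≤-trans deg≤n (≤-trans n≤k (k≤dbl-k k))

length-polyOf : ∀ {n} (c : Vec Bool n) → length (polyOf c) ≡ n
length-polyOf [] = refl
length-polyOf (_ ∷ c) = cong suc (length-polyOf c)

mainTheorem6 : (n : ℕ) → 1 ≤ n → (c : Vec Bool (suc n)) →
    lookup c zero ≡ true → lookup c (fromℕ n) ≡ true →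
    NonincreasingFrom n (S₁ n (polyOf c)) × NonincreasingFrom n (S₂ n (polyOf c))
mainTheorem6 n _ (true ∷ c) refl _ =
  Aᵢ∩B₁∩B₂-nonincreasing n (polyOf c) deg≤n A₁ A₁-truncate ,
  Aᵢ∩B₁∩B₂-nonincreasing n (polyOf c) deg≤n A₂ A₂-truncate
  where deg≤n = ≤-reflexive (length-polyOf c)
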